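{- For every closed de Bruijn term $t'$, every term $t$ and every environment $e$: $\langle 0, [\,]_\rho, (t,e)\rangle_{\mathsf{ind}} \xrightarrow{\mathrm{Seq}(t')} \langle t, (t',\epsilon)::e, [\,]\rangle_{\mathsf{ev}}$ in the AB machine.
   Context: De Bruijn terms $t,s ::= n\mid t\,s\mid\lambda.t$ ($n\in\mathbb N$); $t$ is closed if every index $n$ occurs under at least $n+1$ enclosing $\lambda$'s. Closures $\sigma ::= (t,e)$, environments $e ::= \sigma::e\mid\epsilon$, stacks $\pi ::= \sigma::\pi\mid[\,]$, application stacks $\rho ::= (t,k)::\rho\mid[\,]_\rho$ with $k\in\mathbb N$. AB machine: configurations $\langle t,e,\pi\rangle_{\mathsf{ev}}$, $\langle n,\rho,\sigma\rangle_{\mathsf{ind}}$, $\langle t,k,\rho,\sigma\rangle_{\mathsf{tm}}$. Transitions: $\langle t\,s,e,\pi\rangle_{\mathsf{ev}}\xrightarrow{\tau}\langle t,e,(s,e)::\pi\rangle_{\mathsf{ev}}$; $\langle 0,(t,e)::d,\pi\rangle_{\mathsf{ev}}\xrightarrow{\tau}\langle t,e,\pi\rangle_{\mathsf{ev}}$; $\langle n+1,(t,e)::d,\pi\rangle_{\mathsf{ev}}\xrightarrow{\tau}\langle n,d,\pi\rangle_{\mathsf{ev}}$; $\langle\lambda.t,e,\sigma::\pi\rangle_{\mathsf{ev}}\xrightarrow{\tau}\langle t,\sigma::e,\pi\rangle_{\mathsf{ev}}$; $\langle\lambda.t,e,[\,]\rangle_{\mathsf{ev}}\xrightarrow{\mathsf{arg}}\langle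 0,[\,]_\rho,(t,e)\rangle_{\mathsf{ind}}$; $\langle n,\rho,\sigma\rangle_{\mathsf{ind}}\xrightarrow{\mathsf{suc}}\langle n+1,\rho,\sigma\rangle_{\mathsf{ind}}$; $\langle n,\rho,\sigma\rangle_{\mathsf{ind}}\xrightarrow{\mathsf{var}}\langle n,n+1,\rho,\sigma\rangle_{\mathsf{tm}}$; $\langle t,k+1,\rho,\sigma\rangle_{\mathsf{tm}}\xrightarrow{\mathsf{lam}}\langle\lambda.t,k,\rho,\sigma\rangle_{\mathsf{tm}}$; $\langle t,0,\rho,\sigma\rangle_{\mathsf{tm}}\xrightarrow{\mathsf{lam}}\langle\lambda.t,0,\rho,\sigma\rangle_{\mathsf{tm}}$; $\langle t,k,\rho,\sigma\rangle_{\mathsf{tm}}\xrightarrow{\mathsf{appfun}}\langle 0,(t,k)::\rho,\sigma\rangle_{\mathsf{ind}}$; $\langle s,k_1,(t,k_2)::\rho,\sigma\rangle_{\mathsf{tm}}\xrightarrow{\mathsf{app}}\langle t\,s,\max(k_1,k_2),\rho,\sigma\rangle_{\mathsf{tm}}$; $\langle t,0,[\,]_\rho,(s,e)\rangle_{\mathsf{tm}}\xrightarrow{\mathsf{done}}\langle s,(t,\epsilon)::e,[\,]\rangle_{\mathsf{ev}}$. Flag sequences: $\mathrm{Seq}(t) = (\mathrm{Seq}'(t),\mathsf{done})$, $\mathrm{Seq}'(t\,s) = (\mathrm{Seq}'(t),\mathsf{appfun},\mathrm{Seq}'(s),\mathsf{app})$, $\mathrm{Seq}'(\lambda.t) = (\mathrm{Seq}'(t),\mathsf{lam})$,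 $\mathrm{Seq}'(n) = (\mathrm{Seq}_{\mathrm{int}}(n),\mathsf{var})$, $\mathrm{Seq}_{\mathrm{int}}(0)=()$, $\mathrm{Seq}_{\mathrm{int}}(n+1) = (\mathrm{Seq}_{\mathrm{int}}(n),\mathsf{suc})$, where nested sequences are flattened. $C\xrightarrow{\mathrm{Seq}(t)}C'$ means $C\xrightarrow{F_1}\cdots\xrightarrow{F_m}C'$ where $\mathrm{Seq}(t) = (F_1,\dots,F_m)$. -}

module Defs where

open import Data.Nat using (ℕ; zero; suc; _<_; _⊔_)
open import Data.List using (List; []; _∷_; _++_)
open import Data.Product using (_×_; _,_)

data Term : Set where
  var : ℕ → Term
  app : Term → Term → Term
  lam : Term → Term

data ClosedAt : ℕ → Term → Set where
  cvar : ∀ {d n} → n < d → ClosedAt d (var n)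
  capp : ∀ {d t s} → ClosedAt d t → ClosedAt d s → ClosedAt d (app t s)
  clam : ∀ {d t} → ClosedAt (suc d) t → ClosedAt d (lam t)

Closed : Term → Set
Closed = ClosedAt 0

data Closure : Set
data Env : Set

data Closure where
  clo : Term → Env → Closure

data Env where
  _∷ₑ_ : Closure → Env → Env
  ε    : Env

data Stack : Set where
  _∷ₛ_ : Closure → Stack → Stack
  []ₛ  : Stack

data AppStack : Set where
  _∷ᵨ_ : (Term × ℕ) → AppStack → AppStack
  []ᵨ  : AppStack

data Conf : Set where
  ev  : Term → Env → Stack → Conf
  ind : ℕ → AppStack → Closure → Conf
  tm  : Term → ℕ → AppStack → Closure → Conf

data Flag : Set where
  τ arg suc' var' lam' appfun app' done : Flag

data _—[_]→_ : Conf → Flag → Conf → Set where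
  ev-app   : ∀ {t s e π} → ev (app t s) e π —[ τ ]→ ev t e (clo s e ∷ₛ π)
  ev-zero  : ∀ {t e d π} → ev (var zero) (clo t e ∷ₑ d) π —[ τ ]→ ev t e π
  ev-suc   : ∀ {n t e d π} → ev (var (suc n)) (clo t e ∷ₑ d) π —[ τ ]→ ev (var n) d π
  ev-lam   : ∀ {t e σ π} → ev (lam t) e (σ ∷ₛ π) —[ τ ]→ ev t (σ ∷ₑ e) π
  ev-arg   : ∀ {t e} → ev (lam t) e []ₛ —[ arg ]→ ind zero []ᵨ (clo t e)
  ind-suc  : ∀ {n ρ σ} → ind n ρ σ —[ suc' ]→ ind (suc n) ρ σ
  ind-var  : ∀ {n ρ σ} → ind n ρ σ —[ var' ]→ tm (var n) (suc n) ρ σ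
  tm-lam   : ∀ {t k ρ σ} → tm t (suc k) ρ σ —[ lam' ]→ tm (lam t) k ρ σ
  tm-lam0  : ∀ {t ρ σ} → tm t zero ρ σ —[ lam' ]→ tm (lam t) zero ρ σ
  tm-appfun : ∀ {t k ρ σ} → tm t k ρ σ —[ appfun ]→ ind zero ((t , k) ∷ᵨ ρ) σ
  tm-app   : ∀ {s k₁ t k₂ ρ σ} →
             tm s k₁ ((t , k₂) ∷ᵨ ρ) σ —[ app' ]→ tm (app t s) (k₁ ⊔ k₂) ρ σ
  tm-done  : ∀ {t s e} → tm t zero []ᵨ (clo s e) —[ done ]→ ev s (clo t ε ∷ₑ e) []ₛ

data _—[_]→*_ : Conf → List Flag → Conf → Set where
  nil  : ∀ {C} → C —[ [] ]→* C
  cons : ∀ {C C' C'' F Fs} → C —[ F ]→ C' → C' —[ Fs ]→* C'' → C —[ F ∷ Fs ]→* C''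

SeqInt : ℕ → List Flag
SeqInt zero = []
SeqInt (suc n) = SeqInt n ++ (suc' ∷ [])

Seq' : Term → List Flag
Seq' (app t s) = Seq' t ++ (appfun ∷ []) ++ Seq' s ++ (app' ∷ [])
Seq' (lam t)   = Seq' t ++ (lam' ∷ [])
Seq' (var n)   = SeqInt n ++ (var' ∷ [])

Seq : Term → List Flag
Seq t = Seq' t ++ (done ∷ [])

{-# OPTIONS --safe #-}
module Submission where

-- Running the flags Seq' t from an ind-state rebuilds t bottom-up, and the
-- counter k of the resulting tm-state is the number of enclosing λ's that t
-- still needs to become closed.  For a closed t' this counter is 0, so the
-- final done step fires and installs t' in the environment.

open import Defs
open import Data.Nat using (ℕ; zero; suc; _⊔_; _≤_; pred)
open import Data.Nat.Properties using (⊔-lub; n≤0⇒n≡0; pred-mono-≤)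
open import Data.List using ([]; _∷_; _++_)
open import Data.Product using (_,_)
open import Relation.Binary.PropositionalEquality using (_≡_)

_++*_ : ∀ {C C′ C″ Fs Gs} →
        C —[ Fs ]→* C′ → C′ —[ Gs ]→* C″ → C —[ Fs ++ Gs ]→* C″
nil      ++* q = q
cons x p ++* q = cons x (p ++* q)

[_]* : ∀ {C C′ F} → C —[ F ]→ C′ → C —[ F ∷ [] ]→* C′
[ x ]* = cons x nil

minDepth : Term → ℕ
minDepth (var n)   = suc n
minDepth (app t s) = minDepth s ⊔ minDepth t
minDepth (lam t)   = pred (minDepth t)

ClosedAt⇒minDepth≤ : ∀ {d t} → ClosedAt d t → minDepth t ≤ d
ClosedAt⇒minDepth≤ (cvar n<d)   = n<d
ClosedAt⇒minDepth≤ (capp ct cs) = ⊔-lub (ClosedAt⇒minDepth≤ cs) (ClosedAt⇒minDepth≤ ct)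
ClosedAt⇒minDepth≤ (clam ct)    = pred-mono-≤ (ClosedAt⇒minDepth≤ ct)

Closed⇒minDepth≡0 : ∀ {t} → Closed t → minDepth t ≡ 0
Closed⇒minDepth≡0 ct = n≤0⇒n≡0 (ClosedAt⇒minDepth≤ ct)

SeqInt-steps : ∀ n {ρ σ} → ind 0 ρ σ —[ SeqInt n ]→* ind n ρ σ
SeqInt-steps zero    = nil
SeqInt-steps (suc n) = SeqInt-steps n ++* [ ind-suc ]*

lam-step : ∀ t k {ρ σ} → tm t k ρ σ —[ lam' ∷ [] ]→* tm (lam t) (pred k) ρ σ
lam-step t zero    = [ tm-lam0 ]*
lam-step t (suc k) = [ tm-lam ]*

Seq'-steps : ∀ t {ρ σ} → ind 0 ρ σ —[ Seq' t ]→* tm t (minDepth t) ρ σ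
Seq'-steps (var n)   = SeqInt-steps n ++* [ ind-var ]*
Seq'-steps (app t s) = Seq'-steps t ++* ([ tm-appfun ]* ++* (Seq'-steps s ++* [ tm-app ]*))
Seq'-steps (lam t)   = Seq'-steps t ++* lam-step t (minDepth t)

lemma5p5 : ∀ (t' t : Term) (e : Env) → Closed t' →
    ind 0 []ᵨ (clo t e) —[ Seq t' ]→* ev t (clo t' ε ∷ₑ e) []ₛ
lemma5p5 t' t e ct' = Seq'-steps t' ++* finish
  where
  finish : tm t' (minDepth t') []ᵨ (clo t e) —[ done ∷ [] ]→* ev t (clo t' ε ∷ₑ e) []ₛ
  finish rewrite Closed⇒minDepth≡0 ct' = [ tm-done ]*
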